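{- Let $t\ge3$ and let $(G,\mathcal F)$ be a clean instance of Extended $K_t$-Hitting. (i) If $\mathcal P$ is an additive partition of $G$, then for every $C\in\mathcal P$ the instance $(G[C],\mathcal F\cap C)$ is clean. (ii) If $v\in V(G)$ is such that some optimal solution of $(G,\mathcal F)$ contains $v$, then $(G-v,\mathcal F-v)$ is clean.
   Context: A $t$-clique is a set of $t$ pairwise adjacent vertices; $\mathrm{opt}(G)$ is the minimum size of a set intersecting all $t$-cliques of $G$. An instance of Extended $K_t$-Hitting is a pair $(G,\mathcal F)$ with $\mathcal F$ a set of subsets $Z\subseteq V(G)$, $1\le|Z|\le t-1$, $G[Z]$ a clique; an (optimal) solution is a (minimum) set intersecting all $t$-cliques of $G$ and all $Z\in\mathcal F$, of size $\mathrm{opt}(G,\mathcal F)$. $(G,\mathcal F)$ is clean if $\mathrm{opt}(G,\mathcal F)=\mathrm{opt}(G)$. A partition $\mathcal P$ of $V(G)$ is additive if $\mathrm{opt}(G)=\sum_{C\in\mathcal P}\mathrm{opt}(G[C])$. For $V'\subseteq V(G)$, $\mathcal F\cap V'=\{Z\in\mathcal F: Z\subseteq V'\}$, and $\mathcal F-v=\{Z\in\mathcal F: v\notin Z\}$. -}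

module Defs where

open import Data.Nat using (ℕ; _≤_; _∸_; _+_)
open import Data.Fin using (Fin)
open import Data.Fin.Subset using (Subset; _∈_; _∉_; _⊆_; _∩_; ∣_∣; Nonempty; ⊤; _-_)
open import Data.List using (List; []; _∷_; sum)
open import Data.List.Membership.Propositional using () renaming (_∈_ to _∈L_)
open import Data.Product using (Σ; ∃; _×_; _,_)
open import Data.Empty using (⊥)
open import Relation.Binary.PropositionalEquality using (_≡_)
open import Relation.Nullary using (¬_)

record Graph : Set₁ where
  field
    n     : ℕ
    Adj   : Fin n → Fin n → Set
    sym   : ∀ {x y} → Adj x y → Adj y x
    irrefl : ∀ {x} → ¬ Adj x x
open Graph public

-- Vertex sets are subsets of Fin n.  An induced subgraph G[U] is handled by
-- working "inside" a vertex set U : Subset n; a set K ⊆ U is a clique of G[U]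
-- iff it is a clique of G.

IsClique : (G : Graph) → Subset (n G) → Set
IsClique G K = ∀ x y → x ∈ K → y ∈ K → ¬ (x ≡ y) → Adj G x y

IsTClique : (G : Graph) (t : ℕ) (U : Subset (n G)) → Subset (n G) → Set
IsTClique G t U K = K ⊆ U × IsClique G K × ∣ K ∣ ≡ t

Family : Graph → Set₁
Family G = Subset (n G) → Set

∅F : (G : Graph) → Family G
∅F G Z = ⊥

IsInstance : (G : Graph) (t : ℕ) (U : Subset (n G)) → Family G → Set
IsInstance G t U F =
  ∀ Z → F Z → Z ⊆ U × 1 ≤ ∣ Z ∣ × ∣ Z ∣ ≤ t ∸ 1 × IsClique G Z

IsSolution : (G : Graph) (t : ℕ) (U : Subset (n G)) → Family G → Subset (n G) → Set
IsSolution G t U F S =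
  S ⊆ U
  × (∀ K → IsTClique G t U K → Nonempty (K ∩ S))
  × (∀ Z → F Z → Nonempty (Z ∩ S))

IsOptimalSolution : (G : Graph) (t : ℕ) (U : Subset (n G)) → Family G → Subset (n G) → Set
IsOptimalSolution G t U F S =
  IsSolution G t U F S × (∀ S' → IsSolution G t U F S' → ∣ S ∣ ≤ ∣ S' ∣)

-- k = opt(G[U], 𝓕).  With the empty family this is k = opt(G[U]).
IsOpt : (G : Graph) (t : ℕ) (U : Subset (n G)) → Family G → ℕ → Set
IsOpt G t U F k = ∃ λ S → IsOptimalSolution G t U F S × ∣ S ∣ ≡ k

IsClean : (G : Graph) (t : ℕ) (U : Subset (n G)) → Family G → Set
IsClean G t U F = ∃ λ k → IsOpt G t U F k × IsOpt G t U (∅F G) k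

restrictF : (G : Graph) → Family G → Subset (n G) → Family G
restrictF G F V' Z = F Z × Z ⊆ V'

deleteF : (G : Graph) → Family G → Fin (n G) → Family G
deleteF G F v Z = F Z × v ∉ Z

IsPartition : (G : Graph) (U : Subset (n G)) → List (Subset (n G)) → Set
IsPartition G U P =
  (∀ C → C ∈L P → Nonempty C × C ⊆ U)
  × Disjoint P
  × (∀ x → x ∈ U → ∃ λ C → C ∈L P × x ∈ C)
  where
  Disjoint : List (Subset (n G)) → Set
  Disjoint [] = Data.Unit.⊤ where import Data.Unit
  Disjoint (C ∷ Cs) = (∀ D → D ∈L Cs → ∀ x → x ∈ C → x ∉ D) × Disjoint Cs

IsAdditive : (G : Graph) (t : ℕ) → List (Subset (n G)) → Set
IsAdditive G t P = Σ ℕ λ total → IsOpt G t ⊤ (∅F G) total × SumOpt P total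
  where
  SumOpt : List (Subset (n G)) → ℕ → Set
  SumOpt [] s = s ≡ 0
  SumOpt (C ∷ Cs) s = ∃ λ k → ∃ λ r → IsOpt G t C (∅F G) k × SumOpt Cs r × s ≡ k + r

IsAdditivePartition : (G : Graph) (t : ℕ) → List (Subset (n G)) → Set
IsAdditivePartition G t P = IsPartition G ⊤ P × IsAdditive G t P

{-# OPTIONS --safe #-}
-- Both parts rest on one observation: if a solution S of (G[U], 𝓕) is no larger than any
-- solution of G[U] alone, then S is optimal for both problems and the instance is clean.
-- (i) An optimal solution T of (G, 𝓕) splits over the blocks of P; each piece T ∩ C solves
-- (G[C], 𝓕 ∩ C), so opt(G[C]) ≤ ∣T ∩ C∣, while Σ ∣T ∩ C∣ ≤ ∣T∣ = opt(G) = Σ opt(G[C]):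
-- every one of these inequalities is tight.
-- (ii) If v ∈ S with S optimal for (G, 𝓕), then S - v solves (G - v, 𝓕 - v), and any solution
-- S' of G - v extends to the solution S' ∪ {v} of G, so ∣S∣ = opt(G) ≤ ∣S'∣ + 1.
module Submission where

open import Defs
open import Data.Nat using (ℕ; suc; _+_; _≤_; z≤n; s≤s)
open import Data.Nat.Properties
  using ( +-suc; +-comm; ≤-trans; ≤-pred; n≤1+n; +-mono-≤; +-monoˡ-≤; +-monoʳ-≤
        ; +-cancelˡ-≤; +-cancelʳ-≤; module ≤-Reasoning)
open import Data.Nat.ListAction using (sum)
open import Data.Fin using (Fin)
open import Data.Fin.Subset
  using (Subset; inside; outside; _∈_; _∉_; _⊆_; _∩_; _∪_; _─_; _-_; ⊤; ⁅_⁆; ∣_∣; Nonempty)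
open import Data.Fin.Subset.Properties
  using ( _∈?_; ∈⊤; x∈⁅x⁆; ∣⁅x⁆∣≡1; x∈p∩q⁺; x∈p∩q⁻; x∈p∪q⁺; x∈p∧x∉q⇒x∈p─q; x∈p∧x≢y⇒x∈p-y
        ; x∈p⇒∣p-x∣<∣p∣; p⊆q⇒∣p∣≤∣q∣)
open import Data.List using (List; []; _∷_; map)
open import Data.List.Membership.Propositional using () renaming (_∈_ to _∈L_)
open import Data.List.Relation.Unary.All as All using (All; []; _∷_)
open import Data.List.Relation.Unary.AllPairs using (AllPairs; []; _∷_)
open import Data.List.Relation.Unary.Any using (here; there)
open import Data.List.Relation.Binary.Pointwise using (Pointwise; []; _∷_)
open import Data.Product using (_×_; ∃; _,_; proj₁; proj₂)
open import Data.Sum using (inj₁; inj₂)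
open import Data.Vec using ([]; _∷_)
open import Data.Vec.Base using (here; there)
open import Function using (_∘_)
open import Relation.Nullary using (yes; no)
open import Relation.Binary.PropositionalEquality using (_≡_; _≢_; refl; cong; trans)

x∈p─q⇒x∉q : ∀ {m} {x : Fin m} {p q : Subset m} → x ∈ p ─ q → x ∉ q
x∈p─q⇒x∉q {p = _ ∷ _} {outside ∷ _} here ()
x∈p─q⇒x∉q {p = _ ∷ _} {_ ∷ _} (there x∈p─q) (there x∈q) = x∈p─q⇒x∉q x∈p─q x∈q

x∈p-y⇒x≢y : ∀ {m} {x y : Fin m} {p : Subset m} → x ∈ p - y → x ≢ y
x∈p-y⇒x≢y x∈p-y refl = x∈p─q⇒x∉q x∈p-y (x∈⁅x⁆ _)

∣p∩q∣+∣p─q∣≡∣p∣ : ∀ {m} (p q : Subset m) → ∣ p ∩ q ∣ + ∣ p ─ q ∣ ≡ ∣ p ∣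
∣p∩q∣+∣p─q∣≡∣p∣ []            []            = refl
∣p∩q∣+∣p─q∣≡∣p∣ (inside  ∷ p) (inside  ∷ q) = cong suc (∣p∩q∣+∣p─q∣≡∣p∣ p q)
∣p∩q∣+∣p─q∣≡∣p∣ (inside  ∷ p) (outside ∷ q) = trans (+-suc _ _) (cong suc (∣p∩q∣+∣p─q∣≡∣p∣ p q))
∣p∩q∣+∣p─q∣≡∣p∣ (outside ∷ p) (inside  ∷ q) = ∣p∩q∣+∣p─q∣≡∣p∣ p q
∣p∩q∣+∣p─q∣≡∣p∣ (outside ∷ p) (outside ∷ q) = ∣p∩q∣+∣p─q∣≡∣p∣ p q

∣p∪q∣≤∣p∣+∣q∣ : ∀ {m} (p q : Subset m) → ∣ p ∪ q ∣ ≤ ∣ p ∣ + ∣ q ∣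
∣p∪q∣≤∣p∣+∣q∣ []            []            = z≤n
∣p∪q∣≤∣p∣+∣q∣ (inside  ∷ p) (inside  ∷ q) = s≤s (≤-trans (∣p∪q∣≤∣p∣+∣q∣ p q) (+-monoʳ-≤ ∣ p ∣ (n≤1+n _)))
∣p∪q∣≤∣p∣+∣q∣ (inside  ∷ p) (outside ∷ q) = s≤s (∣p∪q∣≤∣p∣+∣q∣ p q)
∣p∪q∣≤∣p∣+∣q∣ (outside ∷ p) (inside  ∷ q) rewrite +-suc ∣ p ∣ ∣ q ∣ = s≤s (∣p∪q∣≤∣p∣+∣q∣ p q)
∣p∪q∣≤∣p∣+∣q∣ (outside ∷ p) (outside ∷ q) = ∣p∪q∣≤∣p∣+∣q∣ p q

∩-nonempty-transfer : ∀ {m} {K S S' : Subset m} → (∀ {x} → x ∈ K → x ∈ S → x ∈ S')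
  → Nonempty (K ∩ S) → Nonempty (K ∩ S')
∩-nonempty-transfer {K = K} {S} move (x , x∈K∩S) =
  let x∈K , x∈S = x∈p∩q⁻ K S x∈K∩S in x , x∈p∩q⁺ (x∈K , move x∈K x∈S)

Disjoint : ∀ {m} → Subset m → Subset m → Set
Disjoint C D = ∀ x → x ∈ C → x ∉ D

sum-map-mono : ∀ {A : Set} {f g : A → ℕ} {xs : List A} → All (λ x → f x ≤ g x) xs
  → sum (map f xs) ≤ sum (map g xs)
sum-map-mono []         = z≤n
sum-map-mono (le ∷ les) = +-mono-≤ le (sum-map-mono les)

sum-∣∩∣≤∣∣ : ∀ {m} {Cs : List (Subset m)} → AllPairs Disjoint Cs → ∀ S
  → sum (map (λ C → ∣ S ∩ C ∣) Cs) ≤ ∣ S ∣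
sum-∣∩∣≤∣∣ []                          S = z≤n
sum-∣∩∣≤∣∣ {Cs = C ∷ Cs} (C#Cs ∷ Cs#) S = begin
  ∣ S ∩ C ∣ + sum (map (λ D → ∣ S ∩ D ∣) Cs)
    ≤⟨ +-monoʳ-≤ ∣ S ∩ C ∣ (sum-map-mono (All.map ∣S∩D∣≤∣S─C∩D∣ C#Cs)) ⟩
  ∣ S ∩ C ∣ + sum (map (λ D → ∣ (S ─ C) ∩ D ∣) Cs)
    ≤⟨ +-monoʳ-≤ ∣ S ∩ C ∣ (sum-∣∩∣≤∣∣ Cs# (S ─ C)) ⟩
  ∣ S ∩ C ∣ + ∣ S ─ C ∣
    ≡⟨ ∣p∩q∣+∣p─q∣≡∣p∣ S C ⟩
  ∣ S ∣
    ∎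
  where
  open ≤-Reasoning
  ∣S∩D∣≤∣S─C∩D∣ : ∀ {D} → Disjoint C D → ∣ S ∩ D ∣ ≤ ∣ (S ─ C) ∩ D ∣
  ∣S∩D∣≤∣S─C∩D∣ {D} C#D = p⊆q⇒∣p∣≤∣q∣ λ {x} x∈S∩D →
    let x∈S , x∈D = x∈p∩q⁻ S D x∈S∩D
    in x∈p∩q⁺ (x∈p∧x∉q⇒x∈p─q x∈S (λ x∈C → C#D x x∈C x∈D) , x∈D)

module _ {A : Set} {R : A → ℕ → Set} (f : A → ℕ) (R⇒≤ : ∀ {x k} → R x k → k ≤ f x) where

  sum≤sum-map : ∀ {xs ks} → Pointwise R xs ks → sum ks ≤ sum (map f xs)
  sum≤sum-map []       = z≤n
  sum≤sum-map (r ∷ rs) = +-mono-≤ (R⇒≤ r) (sum≤sum-map rs)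

  lower-bounds-tight : ∀ {xs ks} → Pointwise R xs ks → sum (map f xs) ≤ sum ks
    → ∀ {x} → x ∈L xs → ∃ λ k → R x k × f x ≤ k
  lower-bounds-tight {x ∷ _} {k ∷ ks} (r ∷ rs) le (here refl) =
    k , r , +-cancelʳ-≤ (sum ks) (f x) k (≤-trans (+-monoʳ-≤ (f x) (sum≤sum-map rs)) le)
  lower-bounds-tight {ks = k ∷ _} (r ∷ rs) le (there y∈xs) =
    lower-bounds-tight rs (+-cancelˡ-≤ k _ _ (≤-trans (+-monoˡ-≤ _ (R⇒≤ r)) le)) y∈xs

module Solutions (G : Graph) (t : ℕ) where

  private variable
    U C S S' K : Subset (n G)
    F : Family G
    k : ℕ
    v : Fin (n G)

  solution-forget : IsSolution G t U F S → IsSolution G t U (∅F G) S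
  solution-forget (S⊆U , hits-cliques , _) = S⊆U , hits-cliques , λ _ ()

  tclique-⊤ : IsTClique G t U K → IsTClique G t ⊤ K
  tclique-⊤ (_ , clique , size) = (λ _ → ∈⊤) , clique , size

  opt≤solution : IsOpt G t U F k → IsSolution G t U F S → k ≤ ∣ S ∣
  opt≤solution (_ , (_ , minimal) , refl) = minimal _

  clean-if-minimal : IsSolution G t U F S → (∀ S' → IsSolution G t U (∅F G) S' → ∣ S ∣ ≤ ∣ S' ∣)
    → IsClean G t U F
  clean-if-minimal {S = S} solS minimal =
    ∣ S ∣ , (S , (solS , λ S' → minimal S' ∘ solution-forget) , refl)
          , (S , (solution-forget solS , minimal) , refl)

  clean⇒optimal≤solution : IsClean G t U F → IsOptimalSolution G t U F S
    → IsSolution G t U (∅F G) S' → ∣ S ∣ ≤ ∣ S' ∣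
  clean⇒optimal≤solution (_ , (T , (solT , _) , refl) , optO) (_ , minimal) solS' =
    ≤-trans (minimal T solT) (opt≤solution optO solS')

  solution-restrict : IsSolution G t ⊤ F S → IsSolution G t C (restrictF G F C) (S ∩ C)
  solution-restrict {S = S} {C = C} (_ , hits-cliques , hits-family) =
      (λ x∈S∩C → proj₂ (x∈p∩q⁻ S C x∈S∩C))
    , (λ K K-clique → restrict (proj₁ K-clique) (hits-cliques K (tclique-⊤ K-clique)))
    , (λ Z (FZ , Z⊆C) → restrict Z⊆C (hits-family Z FZ))
    where
    restrict : K ⊆ C → Nonempty (K ∩ S) → Nonempty (K ∩ (S ∩ C))
    restrict K⊆C = ∩-nonempty-transfer λ x∈K x∈S → x∈p∩q⁺ (x∈S , K⊆C x∈K)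

  solution-delete : IsSolution G t ⊤ F S → IsSolution G t (⊤ - v) (deleteF G F v) (S - v)
  solution-delete {S = S} {v = v} (_ , hits-cliques , hits-family) =
      (λ x∈S-v → x∈p∧x≢y⇒x∈p-y ∈⊤ (x∈p-y⇒x≢y x∈S-v))
    , (λ K K-clique → delete (λ v∈K → x∈p-y⇒x≢y (proj₁ K-clique v∈K) refl)
                            (hits-cliques K (tclique-⊤ K-clique)))
    , (λ Z (FZ , v∉Z) → delete v∉Z (hits-family Z FZ))
    where
    delete : v ∉ K → Nonempty (K ∩ S) → Nonempty (K ∩ (S - v))
    delete v∉K = ∩-nonempty-transfer λ x∈K x∈S → x∈p∧x≢y⇒x∈p-y x∈S λ { refl → v∉K x∈K }

  solution-extend : IsSolution G t (⊤ - v) (∅F G) S → IsSolution G t ⊤ (∅F G) (S ∪ ⁅ v ⁆)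
  solution-extend {v = v} {S = S} (_ , hits-cliques , _) = (λ _ → ∈⊤) , hits , λ _ ()
    where
    hits : ∀ K → IsTClique G t ⊤ K → Nonempty (K ∩ (S ∪ ⁅ v ⁆))
    hits K (_ , clique , size) with v ∈? K
    ... | yes v∈K = v , x∈p∩q⁺ (v∈K , x∈p∪q⁺ (inj₂ (x∈⁅x⁆ v)))
    ... | no  v∉K = ∩-nonempty-transfer (λ _ x∈S → x∈p∪q⁺ (inj₁ x∈S))
                      (hits-cliques K (K⊆⊤-v , clique , size))
      where
      K⊆⊤-v : K ⊆ ⊤ - v
      K⊆⊤-v x∈K = x∈p∧x≢y⇒x∈p-y ∈⊤ λ { refl → v∉K x∈K }

IsOpt∅ : (G : Graph) (t : ℕ) → Subset (n G) → ℕ → Set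
IsOpt∅ G t C k = IsOpt G t C (∅F G) k

-- Defs phrases disjointness and the sum of optima through predicates local to `where` blocks,
-- which cannot be named here.  The hypothesis types `_` below are therefore solved by
-- unification at their call sites, where `with C ∷ Q` turns the enclosing block list into a
-- variable X so that the unification problem is a pattern.
mutual
  partition-disjoint : ∀ {G U} (P : List (Subset (n G))) → IsPartition G U P → AllPairs Disjoint P
  partition-disjoint []      _ = []
  partition-disjoint {G} {U} (C ∷ Q) p@(_ , (C#Q , _) , _) =
    All.tabulate (C#Q _) ∷ partition-disjoint-tail G U C Q p

  partition-disjoint-tail : ∀ G U C (Q : List (Subset (n G))) → IsPartition G U (C ∷ Q)
    → AllPairs Disjoint Q
  partition-disjoint-tail G U C Q (_ , (_ , Q#) , _) with C ∷ Q
  ... | X = blocks-disjoint G U X Q Q#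

  blocks-disjoint : ∀ G U (X Q : List (Subset (n G))) → _ → AllPairs Disjoint Q
  blocks-disjoint G U X []      _           = []
  blocks-disjoint G U X (C ∷ Q) (C#Q , Q#) = All.tabulate (C#Q _) ∷ blocks-disjoint G U X Q Q#

  additive-opts : ∀ {G t} (P : List (Subset (n G))) → IsAdditive G t P
    → ∃ λ ks → Pointwise (IsOpt∅ G t) P ks × IsOpt∅ G t ⊤ (sum ks)
  additive-opts []      (_ , opt , refl) = [] , [] , opt
  additive-opts {G} {t} (C ∷ Q) (_ , opt , (k , r , optC , Q-sum , refl))
    with additive-opts-tail G t C Q r Q-sum
  ... | ks , optsQ , refl = k ∷ ks , optC ∷ optsQ , opt

  additive-opts-tail : ∀ G t C (Q : List (Subset (n G))) r → _
    → ∃ λ ks → Pointwise (IsOpt∅ G t) Q ks × r ≡ sum ks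
  additive-opts-tail G t C Q r Q-sum with C ∷ Q
  ... | X = blocks-opts G t X Q r Q-sum

  blocks-opts : ∀ G t (X Q : List (Subset (n G))) r → _
    → ∃ λ ks → Pointwise (IsOpt∅ G t) Q ks × r ≡ sum ks
  blocks-opts G t X []      r refl                            = [] , [] , refl
  blocks-opts G t X (C ∷ Q) r (k , r' , optC , Q-sum , refl) with blocks-opts G t X Q r' Q-sum
  ... | ks , optsQ , refl = k ∷ ks , optC ∷ optsQ , refl

lemma23 : (t : ℕ) → 3 ≤ t → (G : Graph) → (F : Family G)
    → IsInstance G t ⊤ F → IsClean G t ⊤ F
    → ((P : List (Subset (n G))) → IsAdditivePartition G t P
         → ∀ C → C ∈L P → IsClean G t C (restrictF G F C))
      × ((v : Fin (n G)) → (∃ λ S → IsOptimalSolution G t ⊤ F S × v ∈ S)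
         → IsClean G t (⊤ - v) (deleteF G F v))
lemma23 t _ G F _ clean@(_ , (T , optT@(solT , _) , _) , _) = clean-blocks , clean-deletion
  where
  open Solutions G t

  ∣T∣≤opt : ∀ {k} → IsOpt∅ G t ⊤ k → ∣ T ∣ ≤ k
  ∣T∣≤opt (_ , (solO , _) , refl) = clean⇒optimal≤solution clean optT solO

  opt≤∣T∩C∣ : ∀ {C k} → IsOpt∅ G t C k → k ≤ ∣ T ∩ C ∣
  opt≤∣T∩C∣ optC = opt≤solution optC (solution-forget (solution-restrict solT))

  clean-blocks : (P : List (Subset (n G))) → IsAdditivePartition G t P
    → ∀ C → C ∈L P → IsClean G t C (restrictF G F C)
  clean-blocks P (partition , additive) C C∈P =
    let ks , opts , optG = additive-opts P additive
        Σ∣T∩D∣≤Σks = ≤-trans (sum-∣∩∣≤∣∣ (partition-disjoint P partition) T) (∣T∣≤opt optG)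
        kC , optC , ∣T∩C∣≤kC = lower-bounds-tight (λ D → ∣ T ∩ D ∣) opt≤∣T∩C∣ opts Σ∣T∩D∣≤Σks C∈P
    in clean-if-minimal (solution-restrict solT) λ S' solS' →
         ≤-trans ∣T∩C∣≤kC (opt≤solution optC solS')

  clean-deletion : (v : Fin (n G)) → (∃ λ S → IsOptimalSolution G t ⊤ F S × v ∈ S)
    → IsClean G t (⊤ - v) (deleteF G F v)
  clean-deletion v (S , optS@(solS , _) , v∈S) =
    clean-if-minimal (solution-delete solS) λ S' solS' →
      ≤-pred (begin-strict
        ∣ S - v ∣            <⟨ x∈p⇒∣p-x∣<∣p∣ v∈S ⟩
        ∣ S ∣                ≤⟨ clean⇒optimal≤solution clean optS (solution-extend solS') ⟩
        ∣ S' ∪ ⁅ v ⁆ ∣       ≤⟨ ∣p∪q∣≤∣p∣+∣q∣ S' ⁅ v ⁆ ⟩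
        ∣ S' ∣ + ∣ ⁅ v ⁆ ∣   ≡⟨ cong (∣ S' ∣ +_) (∣⁅x⁆∣≡1 v) ⟩
        ∣ S' ∣ + 1           ≡⟨ +-comm ∣ S' ∣ 1 ⟩
        suc ∣ S' ∣           ∎)
    where open ≤-Reasoning
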